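{- Let $G$ and $H$ be finite digraphs and $n<\omega$. Suppose that in the Seurat game $\mathbf{G}^2(G,H)$ (colours red and blue) $\forall$ colours a set $X$ of vertices of $G$ red, and that there is a sequence $(s_0,\ldots,s_n)$ of pairs of natural numbers such that $\vec\tau^n(x)=(s_0,\ldots,s_n)$ for all $x\in X$. If $\exists$ responds by colouring a set $Y$ of vertices of $H$ red, then, unless $|Y|=|X|$ and $\vec\tau^n(y)=(s_0,\ldots,s_n)$ for all $y\in Y$, player $\forall$ has a winning strategy from the resulting position (i.e. in any winning strategy $\exists$ must respond with such a $Y$).
   Context: Digraphs: finite vertex set $V$ with edges $E\subseteq V\times V$ (loops allowed). For a vertex $v$ and $Y\subseteq V$: $\tau_Y(v)=(|E\cap(Y\times\{v\})|,|E\cap(\{v\}\times Y)|)$. The tally-sequence $\vec\tau(v)=(t^v_0,t^v_1,\ldots)$ is defined recursively for all vertices simultaneously: $t^v_0=\tau_V(v)$, and $t^v_{k+1}=\tau_{X^v_k}(v)$ where $X^v_k=\{u\in V:(t^u_0,\ldots,t^u_k)=(t^v_0,\ldots,t^v_k)\}$. $\vec\tau^n(v)=(t^v_0,\ldots,t^v_n)$. Tally-sequences are computed in the digraph containing the vertex. Seurat game $\mathbf{G}^k(G,H)$: two players $\forall,\exists$, a set $\mathbf{Col}$ of $k$ colours. A position is a pair of functions $g:\mathbf{Col}\to\wp(G)$, $h:\mathbf{Col}\to\wp(H)$, initially all empty. In each of $\omega$ rounds $\forall$ chooses a colour $c$, one of the graphs and a subset of its vertices; $\exists$ then chooses a subset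 of the other graph; $c$ is then assigned these two sets (erasing its previous use). The palette of a vertex is the set of colours whose set contains it; $P^G$ is the set of vertices of $G$ with palette exactly $P$. $\forall$ wins in round $n$ if at its beginning (C1) some palette $P$ has $P^G$ empty and $P^H$ nonempty or vice versa, or (C2) there are palettes $P_1,P_2$ with an edge from $P_1^G$ to $P_2^G$ but none from $P_1^H$ to $P_2^H$, or vice versa. $\forall$ has a winning strategy from a position if he can guarantee a win in finitely many further rounds. -}

module Defs where

open import Data.Nat using (ℕ; zero; suc; _+_)
import Data.Nat.Properties as ℕP
open import Data.Bool using (Bool; true; false; if_then_else_)
open import Data.Fin using (Fin; zero; suc)
open import Data.Vec using (Vec; []; _∷_; _∷ʳ_)
import Data.Vec.Properties as VecP
open import Data.Product using (_×_; _,_; ∃; ∃-syntax)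
import Data.Product.Properties as ProdP
open import Data.Sum using (_⊎_)
open import Relation.Nullary using (¬_; Dec; yes; no)
open import Relation.Nullary.Decidable using (⌊_⌋)
open import Relation.Binary.PropositionalEquality using (_≡_)

record Digraph : Set where
  field
    size : ℕ
    E    : Fin size → Fin size → Bool

open Digraph public

V : Digraph → Set
V G = Fin (size G)

VSet : Digraph → Set
VSet G = V G → Bool

count : {m : ℕ} → (Fin m → Bool) → ℕ
count {zero}  p = 0
count {suc m} p = (if p zero then 1 else 0) + count (λ i → p (suc i))

τ : (G : Digraph) → VSet G → V G → ℕ × ℕ
τ G Y v = count (λ u → if Y u then E G u v else false)
        , count (λ u → if Y u then E G v u else false)

full : (G : Digraph) → VSet G
full G _ = true

tallyDec : {k : ℕ} → (a b : Vec (ℕ × ℕ) k) → Dec (a ≡ b)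
tallyDec = VecP.≡-dec (ProdP.≡-dec ℕP._≟_ ℕP._≟_)

tally : (G : Digraph) → (k : ℕ) → V G → Vec (ℕ × ℕ) (suc k)
tally G zero    v = τ G (full G) v ∷ []
tally G (suc k) v =
  tally G k v ∷ʳ τ G (λ u → ⌊ tallyDec (tally G k u) (tally G k v) ⌋) v

Colour : Set
Colour = Fin 2

red : Colour
red = zero

blue : Colour
blue = suc zero

Palette : Set
Palette = Colour → Bool

Colouring : Digraph → Set
Colouring G = Colour → VSet G

HasPalette : (G : Digraph) → Colouring G → Palette → V G → Set
HasPalette G g P v = (c : Colour) → g c v ≡ P c

Inhabited : (G : Digraph) → Colouring G → Palette → Set
Inhabited G g P = ∃[ v ] HasPalette G g P v

EdgeBetween : (G : Digraph) → Colouring G → Palette → Palette → Set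
EdgeBetween G g P₁ P₂ =
  ∃[ u ] ∃[ v ] (HasPalette G g P₁ u × HasPalette G g P₂ v × E G u v ≡ true)

C1 : (G H : Digraph) → Colouring G → Colouring H → Set
C1 G H g h = ∃[ P ] ((¬ Inhabited G g P × Inhabited H h P)
                   ⊎ (Inhabited G g P × ¬ Inhabited H h P))

C2 : (G H : Digraph) → Colouring G → Colouring H → Set
C2 G H g h = ∃[ P₁ ] ∃[ P₂ ] ((EdgeBetween G g P₁ P₂ × ¬ EdgeBetween H h P₁ P₂)
                            ⊎ (¬ EdgeBetween G g P₁ P₂ × EdgeBetween H h P₁ P₂))

recolour : {A : Set} → (Colour → A) → Colour → A → Colour → A
recolour f c S c' with ⌊ Data.Fin._≟_ c c' ⌋
... | true  = S
... | false = f c'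

-- ∀ has a winning strategy from position (g , h): he can force (C1) or
-- (C2) to hold at the beginning of some round after finitely many rounds.
data ForallWins (G H : Digraph) : Colouring G → Colouring H → Set where
  now     : ∀ {g h} → C1 G H g h ⊎ C2 G H g h → ForallWins G H g h
  playInG : ∀ {g h} (c : Colour) (S : VSet G) →
            ((T : VSet H) → ForallWins G H (recolour g c S) (recolour h c T)) →
            ForallWins G H g h
  playInH : ∀ {g h} (c : Colour) (T : VSet H) →
            ((S : VSet G) → ForallWins G H (recolour g c S) (recolour h c T)) →
            ForallWins G H g h

-- We prove more generally, by induction on n, that ∃ must answer a red subset of an n-th tally
-- class of G by an equally large red subset of the same tally class of H. A size mismatch within
-- one colour is always winning: ∀ marks with the other colour a proper subset of the larger class
-- as large as the smaller one, and ∃ either loses at once or leaves a strictly smaller mismatch.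
-- If some y ∈ Y has the wrong tally (and, for n = k + 1, a correct k-tally, since otherwise the
-- induction hypothesis applies), ∀ colours {y} blue and ∃ must colour some {x} ⊆ X blue. Then x
-- and y differ in their number of in- or out-neighbours inside corresponding classes (the full
-- vertex sets, or the k-th tally classes). ∀ reds the non-neighbours of the one with fewer; by
-- the induction hypothesis ∃ must answer inside the corresponding class, so he either reds a
-- neighbour of the other blue vertex, violating (C2), or runs out of non-neighbours.
module Submission where

open import Defs
open import Data.Nat using (ℕ; zero; suc; _+_; _≤_; _<_; z≤n; s≤s)
open import Data.Nat.Properties
  using (_≟_; ≤-trans; ≤-reflexive; m≤n⇒m≤1+n; m<n⇒m<1+n; m≤n⇒m<n∨m≡n;
         <-cmp; <-irrefl; <⇒≱; <⇒≤; +-suc; +-mono-<-≤; suc-injective; ≤-pred;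
         module ≤-Reasoning)
open import Data.Nat.Induction using (<-wellFounded)
open import Induction.WellFounded using (Acc; acc)
open import Data.Bool using (Bool; true; false; not; if_then_else_)
open import Data.Bool.Properties using (not-injective)
open import Data.Fin using (Fin; zero; suc)
import Data.Fin.Properties as Fin
open import Data.Vec using (Vec; []; _∷_; _∷ʳ_)
open import Data.Vec.Properties using (∷ʳ-injectiveˡ)
open import Data.Product using (_×_; _,_; ∃)
open import Data.Product.Properties using (×-≡,≡→≡)
open import Data.Sum using (_⊎_; inj₁; inj₂)
open import Function using (_∘_)
open import Relation.Binary.Definitions using (tri<; tri≈; tri>)
open import Relation.Nullary using (¬_; does; yes; no; contradiction)
open import Relation.Nullary.Decidable using (⌊_⌋; dec-true)
open import Relation.Binary.PropositionalEquality

private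
  variable
    m : ℕ
    A B C : Fin m → Bool
    i : Fin m

infix 4 _⊆_
infixl 6 _∩_

_⊆_ : (Fin m → Bool) → (Fin m → Bool) → Set
A ⊆ B = ∀ i → A i ≡ true → B i ≡ true

_∩_ : (Fin m → Bool) → (Fin m → Bool) → Fin m → Bool
(A ∩ B) i = if A i then B i else false

∩-⊆ˡ : A ∩ B ⊆ A
∩-⊆ˡ {A = A} i e with A i
... | true = refl

∩-⊆ʳ : A ∩ B ⊆ B
∩-⊆ʳ {A = A} i e with A i
... | true = e

⊆-∩ : C ⊆ A → C ⊆ B → C ⊆ A ∩ B
⊆-∩ C⊆A C⊆B i e rewrite C⊆A i e = C⊆B i e

⊆-or-escapee : (A B : Fin m → Bool) → A ⊆ B ⊎ ∃ λ i → A i ≡ true × B i ≡ false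
⊆-or-escapee {zero}  A B = inj₁ λ ()
⊆-or-escapee {suc m} A B with A zero in a | B zero in b | ⊆-or-escapee (A ∘ suc) (B ∘ suc)
... | true  | false | _            = inj₂ (zero , a , b)
... | _     | _     | inj₂ (i , e) = inj₂ (suc i , e)
... | true  | true  | inj₁ A⊆B    = inj₁ λ { zero _ → b ; (suc i) → A⊆B i }
... | false | _     | inj₁ A⊆B    =
  inj₁ λ { zero e → contradiction (trans (sym e) a) λ () ; (suc i) → A⊆B i }

count-empty : count (λ (_ : Fin m) → false) ≡ 0
count-empty {zero}  = refl
count-empty {suc m} = count-empty {m}

count≡0⇒empty : (A : Fin m → Bool) → count A ≡ 0 → ∀ i → A i ≡ false
count≡0⇒empty {suc m} A c with A zero in a
... | false = λ { zero → a ; (suc i) → count≡0⇒empty (A ∘ suc) c i }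

∈⇒count>0 : A i ≡ true → 0 < count A
∈⇒count>0 {A = A} {i = zero}  e rewrite e = s≤s z≤n
∈⇒count>0 {A = A} {i = suc i} e with A zero
... | true  = s≤s z≤n
... | false = ∈⇒count>0 {A = A ∘ suc} e

count>0⇒nonempty : (A : Fin m → Bool) → 0 < count A → ∃ λ i → A i ≡ true
count>0⇒nonempty {suc m} A pos with A zero in a
... | true  = zero , a
... | false with count>0⇒nonempty (A ∘ suc) pos
...   | i , e = suc i , e

count-mono : A ⊆ B → count A ≤ count B
count-mono {zero}  A⊆B = z≤n
count-mono {suc m} {A} {B} A⊆B
  with A zero | B zero | A⊆B zero | count-mono {A = A ∘ suc} {B = B ∘ suc} (A⊆B ∘ suc)
... | true  | true  | _    | le = s≤s le
... | true  | false | A⊆B₀ | _  = contradiction (A⊆B₀ refl) λ ()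
... | false | true  | _    | le = m≤n⇒m≤1+n le
... | false | false | _    | le = le

count-mono-< : A ⊆ B → B i ≡ true → A i ≡ false → count A < count B
count-mono-< {suc m} {A} {B} {zero} A⊆B b a rewrite a | b = s≤s (count-mono (A⊆B ∘ suc))
count-mono-< {suc m} {A} {B} {suc i} A⊆B b a
  with A zero | B zero | A⊆B zero | count-mono-< {A = A ∘ suc} {B = B ∘ suc} (A⊆B ∘ suc) b a
... | true  | true  | _    | lt = s≤s lt
... | true  | false | A⊆B₀ | _  = contradiction (A⊆B₀ refl) λ ()
... | false | true  | _    | lt = m<n⇒m<1+n lt
... | false | false | _    | lt = lt

⊆∧count≡⇒⊇ : A ⊆ B → count A ≡ count B → B ⊆ A
⊆∧count≡⇒⊇ {A = A} A⊆B same i b with A i in a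
... | true  = refl
... | false = contradiction (count-mono-< A⊆B b a) (<-irrefl same)

count-split : (A B : Fin m → Bool) → count A ≡ count (A ∩ B) + count (A ∩ (not ∘ B))
count-split {zero}  A B = refl
count-split {suc m} A B with A zero | B zero | count-split (A ∘ suc) (B ∘ suc)
... | true  | true  | eq = cong suc eq
... | true  | false | eq = trans (cong suc eq) (sym (+-suc _ _))
... | false | _     | eq = eq

singleton : Fin m → Fin m → Bool
singleton x u = does (u Fin.≟ x)

singleton-∋ : (x : Fin m) → singleton x x ≡ true
singleton-∋ x = dec-true (x Fin.≟ x) refl

singleton⇒≡ : (x u : Fin m) → singleton x u ≡ true → u ≡ x
singleton⇒≡ x u e with u Fin.≟ x
... | yes u≡x = u≡x

≗singleton-∋ : {x : Fin m} → A ≗ singleton x → A x ≡ true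
≗singleton-∋ {x = x} A≗x = trans (A≗x x) (singleton-∋ x)

≗singleton-unique : {x u : Fin m} → A ≗ singleton x → A u ≡ true → u ≡ x
≗singleton-unique {x = x} {u} A≗x e = singleton⇒≡ x u (trans (sym (A≗x u)) e)

count-singleton : (x : Fin m) → count (singleton x) ≡ 1
count-singleton {suc m} zero    = cong suc (count-empty {m})
count-singleton {suc m} (suc x) = count-singleton x

count≡1⇒singleton : (A : Fin m → Bool) → count A ≡ 1 → ∃ λ x → A ≗ singleton x
count≡1⇒singleton {suc m} A c with A zero in a
... | true  = zero , λ { zero → a ; (suc i) → count≡0⇒empty (A ∘ suc) (suc-injective c) i }
... | false with count≡1⇒singleton (A ∘ suc) c
...   | x , A≗x = suc x , λ { zero → a ; (suc i) → A≗x i }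

takeFirst : ℕ → (Fin m → Bool) → Fin m → Bool
takeFirst zero    A i       = false
takeFirst (suc k) A zero    = A zero
takeFirst (suc k) A (suc i) = takeFirst (if A zero then k else suc k) (A ∘ suc) i

takeFirst-⊆ : (k : ℕ) → takeFirst k A ⊆ A
takeFirst-⊆ (suc k) zero    e = e
takeFirst-⊆ {A = A} (suc k) (suc i) e = takeFirst-⊆ {A = A ∘ suc} (if A zero then k else suc k) i e

count-takeFirst : (k : ℕ) (A : Fin m → Bool) → k ≤ count A → count (takeFirst k A) ≡ k
count-takeFirst {m}     zero    A _ = count-empty {m}
count-takeFirst {suc m} (suc k) A k≤count with A zero
... | true  = cong suc (count-takeFirst k (A ∘ suc) (≤-pred k≤count))
... | false = count-takeFirst (suc k) (A ∘ suc) k≤count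

private
  variable
    G H : Digraph

palette : (Colour → Fin m → Bool) → Fin m → Palette
palette g v c = g c v

forallWins-sym : {g : Colouring G} {h : Colouring H} → ForallWins G H g h → ForallWins H G h g
forallWins-sym (now (inj₁ (P , inj₁ (a , b))))     = now (inj₁ (P , inj₂ (b , a)))
forallWins-sym (now (inj₁ (P , inj₂ (a , b))))     = now (inj₁ (P , inj₁ (b , a)))
forallWins-sym (now (inj₂ (P , Q , inj₁ (a , b)))) = now (inj₂ (P , Q , inj₂ (b , a)))
forallWins-sym (now (inj₂ (P , Q , inj₂ (a , b)))) = now (inj₂ (P , Q , inj₁ (b , a)))
forallWins-sym (playInG c S win) = playInH c S λ T → forallWins-sym (win T)
forallWins-sym (playInH c T win) = playInG c T λ S → forallWins-sym (win S)

colourInclusion-violated : {g : Colouring G} {h : Colouring H} (c₁ c₂ : Colour) (u : V G) →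
                           g c₁ u ≡ true → g c₂ u ≡ false → h c₁ ⊆ h c₂ → ForallWins G H g h
colourInclusion-violated {H = H} {g = g} {h = h} c₁ c₂ u in₁ out₂ h₁⊆h₂ =
  now (inj₁ (palette g u , inj₂ ((u , λ _ → refl) , unmatched)))
  where
  unmatched : ¬ Inhabited H h (palette g u)
  unmatched (v , same) =
    contradiction (trans (sym (h₁⊆h₂ v (trans (same c₁) in₁))) (trans (same c₂) out₂)) λ ()

-- d = true selects in-neighbours and d = false out-neighbours, matching the two components of τ.
neighbours : (G : Digraph) → Bool → V G → VSet G
neighbours G true  v u = E G u v
neighbours G false v u = E G v u

edge-violated : {g : Colouring G} {h : Colouring H} (c₁ c₂ : Colour) (d : Bool) (r x : V G) →
                g c₁ r ≡ true → g c₂ x ≡ true → neighbours G d x r ≡ true →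
                (∀ u v → h c₁ u ≡ true → h c₂ v ≡ true → neighbours H d v u ≡ false) →
                ForallWins G H g h
edge-violated {H = H} {g = g} {h = h} c₁ c₂ true r x r₁ x₂ edge noEdge =
  now (inj₂ (palette g r , palette g x , inj₁ ((r , x , (λ _ → refl) , (λ _ → refl) , edge) , absent)))
  where
  absent : ¬ EdgeBetween H h (palette g r) (palette g x)
  absent (u , v , u≈r , v≈x , e) =
    contradiction (trans (sym e) (noEdge u v (trans (u≈r c₁) r₁) (trans (v≈x c₂) x₂))) λ ()
edge-violated {H = H} {g = g} {h = h} c₁ c₂ false r x r₁ x₂ edge noEdge =
  now (inj₂ (palette g x , palette g r , inj₁ ((x , r , (λ _ → refl) , (λ _ → refl) , edge) , absent)))
  where
  absent : ¬ EdgeBetween H h (palette g x) (palette g r)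
  absent (u , v , u≈x , v≈r , e) =
    contradiction (trans (sym e) (noEdge v u (trans (v≈r c₁) r₁) (trans (u≈x c₂) x₂))) λ ()

other : Colour → Colour
other zero       = suc zero
other (suc zero) = zero

recolour-same : {X : Set} (f : Colour → X) (c : Colour) (S : X) → recolour f c S c ≡ S
recolour-same f zero       S = refl
recolour-same f (suc zero) S = refl

recolour-other : {X : Set} (f : Colour → X) (c : Colour) (S : X) → recolour f (other c) S c ≡ f c
recolour-other f zero       S = refl
recolour-other f (suc zero) S = refl

-- ∀ uses the other colour to mark in H a proper subset EH of h c as large as g c. If ∃'s answer
-- EG leaves g c, or covers all of g c (so that h c ∖ EH is unmatched), (C1) holds at once;
-- otherwise EG is a smaller class than EH, and the same argument recurses on the other colour.
smallerColourClass-wins : {g : Colouring G} {h : Colouring H} (c : Colour) →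
                          Acc _<_ (count (g c)) → count (g c) < count (h c) → ForallWins G H g h
smallerColourClass-wins {G = G} {H = H} {g = g} {h = h} c (acc smaller) g<h = playInH e EH respond
  where
  e : Colour
  e = other c
  EH : VSet H
  EH = takeFirst (count (g c)) (h c)
  |EH| : count EH ≡ count (g c)
  |EH| = count-takeFirst (count (g c)) (h c) (<⇒≤ g<h)
  g′e : ∀ EG u → recolour g e EG e u ≡ EG u
  g′e EG = cong-app (recolour-same g e EG)
  g′c : ∀ EG u → recolour g e EG c u ≡ g c u
  g′c EG = cong-app (recolour-other g c EG)
  h′e : ∀ v → recolour h e EH e v ≡ EH v
  h′e = cong-app (recolour-same h e EH)
  h′c : ∀ v → recolour h e EH c v ≡ h c v
  h′c = cong-app (recolour-other h c EH)
  respond : (EG : VSet G) → ForallWins G H (recolour g e EG) (recolour h e EH)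
  respond EG with ⊆-or-escapee EG (g c)
  ... | inj₂ (u , u∈EG , u∉g) =
    colourInclusion-violated e c u (trans (g′e EG u) u∈EG) (trans (g′c EG u) u∉g)
      λ v v∈ → trans (h′c v) (takeFirst-⊆ (count (g c)) v (trans (sym (h′e v)) v∈))
  ... | inj₁ EG⊆g with m≤n⇒m<n∨m≡n (count-mono EG⊆g)
  ...   | inj₁ fewer = smallerColourClass-wins e (smaller (subst (_< count (g c)) |g′e| fewer))
                                                  (subst₂ _<_ |g′e| |h′e| fewer)
    where
    |g′e| : count EG ≡ count (recolour g e EG e)
    |g′e| = cong count (sym (recolour-same g e EG))
    |h′e| : count (g c) ≡ count (recolour h e EH e)
    |h′e| = trans (sym |EH|) (cong count (sym (recolour-same h e EH)))
  ...   | inj₂ same with ⊆-or-escapee (h c) EH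
  ...     | inj₁ h⊆EH = contradiction (≤-trans (count-mono h⊆EH) (≤-reflexive |EH|)) (<⇒≱ g<h)
  ...     | inj₂ (v , v∈h , v∉EH) = forallWins-sym
    (colourInclusion-violated c e v (trans (h′c v) v∈h) (trans (h′e v) v∉EH)
      λ u u∈ → trans (g′e EG u) (⊆∧count≡⇒⊇ EG⊆g same u (trans (sym (g′c EG u)) u∈)))

sizeMismatch-wins : {g : Colouring G} {h : Colouring H} (c : Colour) →
                    count (g c) ≢ count (h c) → ForallWins G H g h
sizeMismatch-wins {g = g} {h = h} c g≢h with <-cmp (count (g c)) (count (h c))
... | tri< g<h _ _ = smallerColourClass-wins c (<-wellFounded _) g<h
... | tri≈ _ g≡h _ = contradiction g≡h g≢h
... | tri> _ _ h<g = forallWins-sym (smallerColourClass-wins c (<-wellFounded _) h<g)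

RedForces : (G H : Digraph) → VSet G → VSet H → Set
RedForces G H κG κH =
  (g : Colouring G) (h : Colouring H) (S : VSet G) → S ⊆ κG →
  (R : VSet H) → ¬ (count R ≡ count S × R ⊆ κH) →
  ForallWins G H (recolour g red S) (recolour h red R)

fullClasses-force : RedForces G H (full G) (full H)
fullClasses-force g h S _ R wrong = sizeMismatch-wins red λ S≡R → wrong (sym S≡R , λ _ _ → refl)

largerClass-wins : {κG : VSet G} {κH : VSet H} {g : Colouring G} {h : Colouring H} →
                   RedForces H G κH κG → count κG < count κH → ForallWins G H g h
largerClass-wins {κG = κG} {κH} {g} {h} forces G<H = playInH red κH λ R →
  forallWins-sym (forces h g κH (λ _ e → e) R λ (R≡H , R⊆G) →
    <⇒≱ G<H (≤-trans (≤-reflexive (sym R≡H)) (count-mono R⊆G)))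

degree : (G : Digraph) → VSet G → Bool → V G → ℕ
degree G κ d v = count (κ ∩ neighbours G d v)

-- ∀ colours red the members of κH that are not d-neighbours of y. ∃ must answer inside κG, and
-- without d-neighbours of x, lest (C2) fail between red and blue; but κG has too few of those.
smallerDegree-wins : {κG : VSet G} {κH : VSet H} {g : Colouring G} {h : Colouring H}
                     {x : V G} {y : V H} (d : Bool) →
                     RedForces H G κH κG → count κG ≡ count κH →
                     g blue ≗ singleton x → h blue ≗ singleton y →
                     degree H κH d y < degree G κG d x → ForallWins G H g h
smallerDegree-wins {G = G} {H = H} {κG} {κH} {g} {h} {x} {y} d forces sizes gx hy deg< =
  playInH red S respond
  where
  Nx : VSet G
  Nx = neighbours G d x
  S : VSet H
  S = κH ∩ (not ∘ neighbours H d y)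
  respond : (R : VSet G) → ForallWins G H (recolour g red R) (recolour h red S)
  respond R with ⊆-or-escapee R (not ∘ Nx)
  ... | inj₂ (r , r∈R , r∈Nx) =
    edge-violated red blue d r x r∈R (≗singleton-∋ gx) (not-injective r∈Nx) noEdge
    where
    noEdge : ∀ u v → S u ≡ true → h blue v ≡ true → neighbours H d v u ≡ false
    noEdge u v u∈S v∈blue with ≗singleton-unique hy v∈blue
    ... | refl = not-injective (∩-⊆ʳ {A = κH} {B = not ∘ neighbours H d v} u u∈S)
  ... | inj₁ R⊆¬Nx = forallWins-sym (forces h g S ∩-⊆ˡ R λ (R≡S , R⊆κ) →
    <-irrefl (sym sizes) (begin-strict
      count κH                                 ≡⟨ count-split κH (neighbours H d y) ⟩
      degree H κH d y + count S                <⟨ +-mono-<-≤ deg< (begin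
          count S                                ≡⟨ sym R≡S ⟩
          count R                                ≤⟨ count-mono (⊆-∩ R⊆κ R⊆¬Nx) ⟩
          count (κG ∩ (not ∘ Nx))                ∎) ⟩
      degree G κG d x + count (κG ∩ (not ∘ Nx)) ≡⟨ sym (count-split κG Nx) ⟩
      count κG                                 ∎))
    where open ≤-Reasoning

degreeMismatch-wins : {κG : VSet G} {κH : VSet H} {g : Colouring G} {h : Colouring H}
                      {x : V G} {y : V H} (d : Bool) →
                      RedForces G H κG κH → RedForces H G κH κG →
                      g blue ≗ singleton x → h blue ≗ singleton y →
                      degree G κG d x ≢ degree H κH d y → ForallWins G H g h
degreeMismatch-wins {G = G} {H = H} {κG} {κH} {x = x} {y} d forcesGH forcesHG gx hy deg≢
  with <-cmp (count κG) (count κH)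
... | tri< G<H _ _ = largerClass-wins forcesHG G<H
... | tri> _ _ H<G = forallWins-sym (largerClass-wins forcesGH H<G)
... | tri≈ _ sizes _ with <-cmp (degree G κG d x) (degree H κH d y)
...   | tri< x<y _ _ = forallWins-sym (smallerDegree-wins d forcesGH (sym sizes) hy gx x<y)
...   | tri≈ _ x≡y _ = contradiction x≡y deg≢
...   | tri> _ _ y<x = smallerDegree-wins d forcesHG sizes gx hy y<x

τMismatch-wins : {κG : VSet G} {κH : VSet H} {g : Colouring G} {h : Colouring H}
                 {x : V G} {y : V H} →
                 RedForces G H κG κH → RedForces H G κH κG →
                 g blue ≗ singleton x → h blue ≗ singleton y →
                 τ G κG x ≢ τ H κH y → ForallWins G H g h
τMismatch-wins {G = G} {H = H} {κG} {κH} {x = x} {y} forcesGH forcesHG gx hy τ≢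
  with degree G κG true x ≟ degree H κH true y
... | no  in≢ = degreeMismatch-wins true forcesGH forcesHG gx hy in≢
... | yes in≡ =
  degreeMismatch-wins false forcesGH forcesHG gx hy λ out≡ → τ≢ (×-≡,≡→≡ (in≡ , out≡))

blueSingleton-wins : {g : Colouring G} {h : Colouring H} {X : VSet G} {Y : VSet H} {y : V H} →
                     Y y ≡ true →
                     (∀ x {g′ : Colouring G} {h′ : Colouring H} → X x ≡ true →
                        g′ blue ≗ singleton x → h′ blue ≗ singleton y → ForallWins G H g′ h′) →
                     ForallWins G H (recolour g red X) (recolour h red Y)
blueSingleton-wins {G = G} {H = H} {g = g} {h} {X} {Y} {y} y∈Y win = playInH blue (singleton y) respond
  where
  respond : (S : VSet G) →
            ForallWins G H (recolour (recolour g red X) blue S) (recolour (recolour h red Y) blue (singleton y))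
  respond S with ⊆-or-escapee S X | count S ≟ 1
  ... | inj₂ (u , u∈S , u∉X) | _ =
    colourInclusion-violated blue red u u∈S u∉X
      λ v v≡y → subst (λ v → Y v ≡ true) (sym (singleton⇒≡ y v v≡y)) y∈Y
  ... | inj₁ _   | no ≢1 = sizeMismatch-wins blue λ |S|≡ → ≢1 (trans |S|≡ (count-singleton y))
  ... | inj₁ S⊆X | yes ≡1 with count≡1⇒singleton S ≡1
  ...   | x , S≗x = win x (S⊆X x (≗singleton-∋ S≗x)) S≗x (λ _ → refl)

-- Opaque, so that G, n, s and u can be inferred from a type tallyClass G n s u ≡ true.
opaque
  tallyClass : (G : Digraph) (n : ℕ) → Vec (ℕ × ℕ) (suc n) → VSet G
  tallyClass G n s u = ⌊ tallyDec (tally G n u) s ⌋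

opaque
  unfolding tallyClass

  tallyClass-sound : ∀ {n s} {u : V G} → tallyClass G n s u ≡ true → tally G n u ≡ s
  tallyClass-sound {G = G} {n} {s} {u} e with tallyDec (tally G n u) s
  ... | yes u≡s = u≡s

  tallyClass-complete : ∀ {n s} {u : V G} → tally G n u ≡ s → tallyClass G n s u ≡ true
  tallyClass-complete {G = G} {n} {s} {u} u≡s with tallyDec (tally G n u) s
  ... | yes _   = refl
  ... | no  u≢s = contradiction u≡s u≢s

  tally-suc : ∀ {k t} (u : V G) → tally G k u ≡ t → tally G (suc k) u ≡ t ∷ʳ τ G (tallyClass G k t) u
  tally-suc u refl = refl

tallyClass-false : ∀ {n s} {u : V G} → tallyClass G n s u ≡ false → tally G n u ≢ s
tallyClass-false u∉s u≡s = contradiction (trans (sym u∉s) (tallyClass-complete u≡s)) λ ()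

tallyClass-prefix : ∀ {k s} {u v : V G} →
                    tallyClass G (suc k) s u ≡ true → tallyClass G (suc k) s v ≡ true →
                    tallyClass G k (tally G k v) u ≡ true
tallyClass-prefix u∈s v∈s =
  tallyClass-complete (∷ʳ-injectiveˡ _ _ (trans (tallyClass-sound u∈s) (sym (tallyClass-sound v∈s))))

tallyClasses-force : ∀ n {G H} s → RedForces G H (tallyClass G n s) (tallyClass H n s)

tallyOutlier-wins : ∀ n {G H} s {g : Colouring G} {h : Colouring H} {X : VSet G} {Y : VSet H} {y : V H} →
                    X ⊆ tallyClass G n s → count Y ≡ count X → Y y ≡ true → tally H n y ≢ s →
                    ForallWins G H (recolour g red X) (recolour h red Y)
tallyOutlier-wins zero {G} {H} s {y = y} X⊆s _ y∈Y y≢s = blueSingleton-wins y∈Y λ x x∈X gx hy →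
  τMismatch-wins (fullClasses-force {G} {H}) (fullClasses-force {H} {G}) gx hy λ τ≡ → y≢s (begin
    tally H zero y  ≡⟨ cong (_∷ []) (sym τ≡) ⟩
    tally G zero x  ≡⟨ tallyClass-sound (X⊆s x x∈X) ⟩
    s               ∎)
  where open ≡-Reasoning
tallyOutlier-wins (suc k) {G} {H} s {g} {h} {X} {Y} {y} X⊆s |Y|≡|X| y∈Y y≢s
  with count>0⇒nonempty X (subst (0 <_) |Y|≡|X| (∈⇒count>0 {A = Y} y∈Y))
... | x₀ , x₀∈X = separate (⊆-or-escapee Y (tallyClass H k t))
  where
  t = tally G k x₀
  X⊆t : X ⊆ tallyClass G k t
  X⊆t x x∈X = tallyClass-prefix (X⊆s x x∈X) (X⊆s x₀ x₀∈X)
  separate : Y ⊆ tallyClass H k t ⊎ (∃ λ y₁ → Y y₁ ≡ true × tallyClass H k t y₁ ≡ false) →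
             ForallWins G H (recolour g red X) (recolour h red Y)
  separate (inj₂ (y₁ , y₁∈Y , y₁∉t)) = tallyClasses-force k t g h X X⊆t Y λ (_ , Y⊆t) →
    contradiction (trans (sym y₁∉t) (Y⊆t y₁ y₁∈Y)) λ ()
  separate (inj₁ Y⊆t) = blueSingleton-wins y∈Y λ x x∈X gx hy →
    τMismatch-wins (tallyClasses-force k t) (tallyClasses-force k t) gx hy λ τ≡ → y≢s (begin
      tally H (suc k) y              ≡⟨ tally-suc y (tallyClass-sound (Y⊆t y y∈Y)) ⟩
      t ∷ʳ τ H (tallyClass H k t) y  ≡⟨ cong (t ∷ʳ_) (sym τ≡) ⟩
      t ∷ʳ τ G (tallyClass G k t) x  ≡⟨ sym (tally-suc x (tallyClass-sound (X⊆t x x∈X))) ⟩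
      tally G (suc k) x              ≡⟨ tallyClass-sound (X⊆s x x∈X) ⟩
      s                              ∎)
    where open ≡-Reasoning

tallyClasses-force n {H = H} s g h X X⊆s Y wrong with count Y ≟ count X | ⊆-or-escapee Y (tallyClass H n s)
... | no  |Y|≢|X| | _                    = sizeMismatch-wins red λ |X|≡|Y| → |Y|≢|X| (sym |X|≡|Y|)
... | yes |Y|≡|X| | inj₁ Y⊆s             = contradiction (|Y|≡|X| , Y⊆s) wrong
... | yes |Y|≡|X| | inj₂ (y , y∈Y , y∉s) =
  tallyOutlier-wins n s X⊆s |Y|≡|X| y∈Y (tallyClass-false y∉s)

lemma4p4 : (G H : Digraph) (n : ℕ) (g : Colouring G) (h : Colouring H)
    (X : VSet G) (s : Vec (ℕ × ℕ) (suc n)) →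
    ((x : V G) → X x ≡ true → tally G n x ≡ s) →
    (Y : VSet H) →
    ¬ (count Y ≡ count X × ((y : V H) → Y y ≡ true → tally H n y ≡ s)) →
    ForallWins G H (recolour g red X) (recolour h red Y)
lemma4p4 G H n g h X s X≡s Y wrong =
  tallyClasses-force n s g h X (λ x x∈X → tallyClass-complete (X≡s x x∈X)) Y
    λ (|Y|≡|X| , Y⊆s) → wrong (|Y|≡|X| , λ y y∈Y → tallyClass-sound (Y⊆s y y∈Y))
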